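{- Let $\mathcal{A}$ be a finite totally ordered alphabet. If $w\in\mathcal{A}^{+}$ is a Fibonacci Lyndon word of length $F_n$ with $n\ge 3$, then $\mathcal{L}(w)=n$.
   Context: Lyndon words: nonempty primitive words strictly smallest in their conjugacy class under the lexicographic order. $\mathcal{L}(w)$ is the number of distinct Lyndon factors of $w$. Fibonacci numbers: $F_0=0,F_1=1,F_n=F_{n-1}+F_{n-2}$. For letters $\mathtt{a}<\mathtt{b}$, set $f_1=\mathtt{b}$, $f_2=\mathtt{a}$, $f_n=f_{n-1}f_{n-2}$; for $n\ge3$ let $p_n$ be $f_n$ with its last two letters removed; with $c$ the morphism swapping $\mathtt{a},\mathtt{b}$, the Fibonacci Lyndon words of length $F_n$ over $\{\mathtt{a},\mathtt{b}\}$ are $\mathtt{a}p_n\mathtt{b}$ and $\mathtt{a}c(p_n)\mathtt{b}$. -}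

module Defs where

open import Data.Nat using (ℕ; zero; suc; _∸_)
open import Data.Bool using (Bool; true; false; not)
open import Data.Fin using (Fin; _<_)
open import Data.List using (List; []; _∷_; _++_; map; take; length; concat; replicate)
open import Data.List.Membership.Propositional using (_∈_)
open import Data.List.Relation.Unary.Unique.Propositional using (Unique)
open import Data.Product using (Σ; ∃; _×_; _,_)
open import Data.Sum using (_⊎_)
open import Relation.Binary.PropositionalEquality using (_≡_; _≢_)
open import Function.Bundles using (_⇔_)

-- A finite totally ordered alphabet is (up to order isomorphism) Fin k
-- with its usual order.
Word : ℕ → Set
Word k = List (Fin k)

data _<ₗ_ {k : ℕ} : Word k → Word k → Set where
  []<∷  : ∀ {y ys} → [] <ₗ (y ∷ ys)
  here  : ∀ {x y xs ys} → x < y → (x ∷ xs) <ₗ (y ∷ ys)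
  there : ∀ {x xs ys} → xs <ₗ ys → (x ∷ xs) <ₗ (x ∷ ys)

Primitive : ∀ {k} → Word k → Set
Primitive w = ∀ u m → w ≡ concat (replicate m u) → m ≡ 1

-- Lyndon: nonempty, primitive, strictly smaller than every other element
-- of its conjugacy class (conjugates are the words v ++ u with w = u ++ v).
Lyndon : ∀ {k} → Word k → Set
Lyndon w = (w ≢ []) × Primitive w ×
           (∀ u v → w ≡ u ++ v → v ++ u ≢ w → w <ₗ (v ++ u))

Factor : ∀ {k} → Word k → Word k → Set
Factor u w = ∃ λ x → ∃ λ y → w ≡ x ++ u ++ y

-- 𝓛(w) = m : the set of distinct Lyndon factors of w has exactly m elements.
LyndonCount : ∀ {k} → Word k → ℕ → Set
LyndonCount {k} w m =
  Σ (List (Word k)) λ ls → Unique ls × length ls ≡ m ×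
    (∀ u → (u ∈ ls) ⇔ (Lyndon u × Factor u w))

fib : ℕ → ℕ
fib zero = 0
fib (suc zero) = 1
fib (suc (suc n)) = fib (suc n) + fib n
  where open Data.Nat using (_+_)

-- Fibonacci words over Bool (false = 𝚊, true = 𝚋):
-- f₁ = 𝚋, f₂ = 𝚊, fₙ = fₙ₋₁ fₙ₋₂ (f₀ is an unused dummy).
fibW : ℕ → List Bool
fibW zero = []
fibW (suc zero) = true ∷ []
fibW (suc (suc zero)) = false ∷ []
fibW (suc (suc (suc n))) = fibW (suc (suc n)) ++ fibW (suc n)

pW : ℕ → List Bool
pW n = take (length (fibW n) ∸ 2) (fibW n)

embed : ∀ {k} → Fin k → Fin k → Bool → Fin k
embed a b false = a
embed a b true  = b

-- w is a Fibonacci Lyndon word of length F_n: for some letters a < b,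
-- w = a pₙ b  or  w = a c(pₙ) b  (c swaps a and b).
FibLyndon : ∀ {k} → ℕ → Word k → Set
FibLyndon n w = ∃ λ a → ∃ λ b → a < b ×
  ((w ≡ a ∷ (map (embed a b) (pW n) ++ (b ∷ [])))
   ⊎ (w ≡ a ∷ (map (embed a b) (map not (pW n)) ++ (b ∷ []))))

module Submission where

-- Over 𝚊 < 𝚋 let φ : 𝚊 ↦ 𝚊, 𝚋 ↦ 𝚊𝚋 and ψ : 𝚊 ↦ 𝚊𝚋, 𝚋 ↦ 𝚋.  Both are strictly
-- lexicographically monotone, and every 𝚊 in an image starts, every 𝚋 ends, the
-- image of a subword.  Hence they preserve Lyndon words, and every Lyndon factor
-- of length ≥ 2 of h(u) (it starts with 𝚊 and ends with 𝚋) is the image of a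
-- Lyndon factor of u; so if u contains both letters, h(u) has exactly one more
-- Lyndon factor than u (a single letter).  With p_{n+1} = θ(p_n)𝚊 for the
-- Fibonacci morphism θ, the two Fibonacci Lyndon words satisfy
-- 𝚊p_{n+1}𝚋 = φ(𝚊c(p_n)𝚋) and 𝚊c(p_{n+1})𝚋 = ψ(𝚊p_n𝚋); induction from 𝚊𝚋 (three
-- Lyndon factors) gives n factors, and an order embedding {𝚊, 𝚋} → Fin k
-- transports the count.

open import Defs
open import Data.Nat using (ℕ; zero; suc; _+_; _∸_; _≤_; s≤s; z≤n)
open import Data.Nat.Properties using (m+n∸n≡m)
open import Data.Bool using (Bool; true; false; not)
open import Data.Fin using (Fin; zero; suc; _<_)
import Data.Fin.Properties as Fin
open import Data.List using (List; []; _∷_; _++_; map; length; concat; replicate; take)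
open import Data.List.Properties
  using (∷-injectiveˡ; ∷-injectiveʳ; ++-assoc; ++-identityʳ; ++-conicalʳ; length-++; length-map; map-++)
open import Data.List.Membership.Propositional using (_∈_)
open import Data.List.Membership.Propositional.Properties using (∈-map⁺; ∈-map⁻; ∈-++⁺ˡ; ∈-++⁺ʳ; ∈-++⁻)
open import Data.List.Relation.Unary.Any using (here; there)
open import Data.List.Relation.Unary.All using ([]; _∷_)
open import Data.List.Relation.Unary.AllPairs using ([]; _∷_)
open import Data.List.Relation.Unary.Unique.Propositional using (Unique)
import Data.List.Relation.Unary.Unique.Propositional.Properties as Unique
open import Data.List.Relation.Binary.Disjoint.Propositional using (Disjoint)
open import Data.Product using (∃; ∃₂; _×_; _,_; proj₁; proj₂)
open import Data.Sum using (_⊎_; inj₁; inj₂)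
open import Data.Empty using (⊥-elim)
open import Function.Bundles using (mk⇔; Equivalence)
open import Relation.Nullary using (¬_)
open import Relation.Binary.Definitions using (tri<; tri≈; tri>)
open import Relation.Binary.PropositionalEquality
  using (_≡_; _≢_; refl; sym; trans; cong; cong₂; subst; module ≡-Reasoning)

LyndonFactor : ∀ {k} → Word k → Word k → Set
LyndonFactor u w = Lyndon u × Factor u w

module StrictlyMonotone {A B : Set} (_<ᴬ_ : A → A → Set) (_<ᴮ_ : B → B → Set)
  (compare : ∀ x y → x <ᴬ y ⊎ x ≡ y ⊎ y <ᴬ x)
  (<ᴮ-asym : ∀ {x y} → x <ᴮ y → ¬ y <ᴮ x)
  (f : A → B) (f-mono : ∀ {x y} → x <ᴬ y → f x <ᴮ f y) where

  private
    <ᴮ-irrefl : ∀ {x} → ¬ x <ᴮ x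
    <ᴮ-irrefl x<x = <ᴮ-asym x<x x<x

  injective : ∀ {x y} → f x ≡ f y → x ≡ y
  injective {x} {y} fx≡fy with compare x y
  ... | inj₁ x<y = ⊥-elim (<ᴮ-irrefl (subst (_<ᴮ f y) fx≡fy (f-mono x<y)))
  ... | inj₂ (inj₁ x≡y) = x≡y
  ... | inj₂ (inj₂ y<x) = ⊥-elim (<ᴮ-irrefl (subst (f y <ᴮ_) fx≡fy (f-mono y<x)))

  reflects : ∀ {x y} → f x <ᴮ f y → x <ᴬ y
  reflects {x} {y} fx<fy with compare x y
  ... | inj₁ x<y = x<y
  ... | inj₂ (inj₁ refl) = ⊥-elim (<ᴮ-irrefl fx<fy)
  ... | inj₂ (inj₂ y<x) = ⊥-elim (<ᴮ-asym fx<fy (f-mono y<x))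

module _ {k : ℕ} where

  <ₗ-asym : {x y : Word k} → x <ₗ y → ¬ y <ₗ x
  <ₗ-asym []<∷ ()
  <ₗ-asym (here p) (here q) = Fin.<-asym p q
  <ₗ-asym (here p) (there q) = Fin.<-irrefl refl p
  <ₗ-asym (there p) (here q) = Fin.<-irrefl refl q
  <ₗ-asym (there p) (there q) = <ₗ-asym p q

  <ₗ-compare : (x y : Word k) → x <ₗ y ⊎ x ≡ y ⊎ y <ₗ x
  <ₗ-compare [] [] = inj₂ (inj₁ refl)
  <ₗ-compare [] (y ∷ ys) = inj₁ []<∷
  <ₗ-compare (x ∷ xs) [] = inj₂ (inj₂ []<∷)
  <ₗ-compare (x ∷ xs) (y ∷ ys) with Fin.<-cmp x y
  ... | tri< x<y _ _ = inj₁ (here x<y)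
  ... | tri> _ _ y<x = inj₂ (inj₂ (here y<x))
  ... | tri≈ _ refl _ with <ₗ-compare xs ys
  ...   | inj₁ xs<ys = inj₁ (there xs<ys)
  ...   | inj₂ (inj₁ refl) = inj₂ (inj₁ refl)
  ...   | inj₂ (inj₂ ys<xs) = inj₂ (inj₂ (there ys<xs))

  ++-∷-nonempty : ∀ xs {y : Fin k} {ys} → xs ++ y ∷ ys ≢ []
  ++-∷-nonempty xs e with ++-conicalʳ xs _ e
  ... | ()

  factor-trans : {u v w : Word k} → Factor u v → Factor v w → Factor u w
  factor-trans {u} (x , y , refl) (x′ , y′ , refl) = x′ ++ x , y ++ y′ , regroup
    where
    open ≡-Reasoning
    regroup : x′ ++ (x ++ u ++ y) ++ y′ ≡ (x′ ++ x) ++ u ++ y ++ y′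
    regroup = begin
      x′ ++ (x ++ u ++ y) ++ y′  ≡⟨ cong (x′ ++_) (++-assoc x (u ++ y) y′) ⟩
      x′ ++ x ++ (u ++ y) ++ y′  ≡⟨ cong (λ z → x′ ++ x ++ z) (++-assoc u y y′) ⟩
      x′ ++ x ++ u ++ y ++ y′    ≡⟨ sym (++-assoc x′ x (u ++ y ++ y′)) ⟩
      (x′ ++ x) ++ u ++ y ++ y′  ∎

  power-of-[] : ∀ m → concat (replicate m ([] {A = Fin k})) ≡ []
  power-of-[] zero = refl
  power-of-[] (suc m) = power-of-[] m

  power-of-letter : ∀ m (c : Fin k) → concat (replicate m (c ∷ [])) ≡ replicate m c
  power-of-letter zero c = refl
  power-of-letter (suc m) c = cong (c ∷_) (power-of-letter m c)

  replicate-snoc : ∀ m (c : Fin k) → replicate m c ++ c ∷ [] ≡ c ∷ replicate m c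
  replicate-snoc zero c = refl
  replicate-snoc (suc m) c = cong (c ∷_) (replicate-snoc m c)

  letter-rotation : ∀ {c : Fin k} u v → c ∷ [] ≡ u ++ v → v ++ u ≡ c ∷ []
  letter-rotation [] [] ()
  letter-rotation [] (_ ∷ []) refl = refl
  letter-rotation [] (_ ∷ _ ∷ _) ()
  letter-rotation (_ ∷ []) [] refl = refl
  letter-rotation (_ ∷ []) (_ ∷ _) ()
  letter-rotation (_ ∷ _ ∷ _) _ ()

  no-smaller-rotation : ∀ {w} → Lyndon w → ∀ u v → w ≡ u ++ v → ¬ (v ++ u) <ₗ w
  no-smaller-rotation {w} (_ , _ , minimal) u v w≡uv vu<w =
    <ₗ-asym vu<w (minimal u v w≡uv (λ vu≡w → let w<w = subst (_<ₗ w) vu≡w vu<w in <ₗ-asym w<w w<w))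

  letter-power-imprimitive : (c : Fin k) (m : ℕ) → ¬ Primitive (replicate (suc (suc m)) c)
  letter-power-imprimitive c m prim
    with prim (c ∷ []) (suc (suc m)) (sym (power-of-letter (suc (suc m)) c))
  ... | ()

  letter-lyndon : (c : Fin k) → Lyndon (c ∷ [])
  letter-lyndon c = (λ ()) , single-primitive , minimal
    where
    single-primitive : Primitive (c ∷ [])
    single-primitive u zero ()
    single-primitive u (suc zero) _ = refl
    single-primitive [] (suc (suc m)) e with trans e (power-of-[] m)
    ... | ()
    single-primitive (d ∷ u) (suc (suc m)) e = ⊥-elim (++-∷-nonempty u (sym (∷-injectiveʳ e)))
    minimal : ∀ u v → c ∷ [] ≡ u ++ v → v ++ u ≢ c ∷ [] → (c ∷ []) <ₗ (v ++ u)
    minimal u v e vu≢c = ⊥-elim (vu≢c (letter-rotation u v e))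

  two-letter-factors : ∀ {c d : Fin k} {y} → Factor y (c ∷ d ∷ []) →
                       y ≡ [] ⊎ y ∈ (c ∷ []) ∷ (d ∷ []) ∷ (c ∷ d ∷ []) ∷ []
  two-letter-factors {y = []} _ = inj₁ refl
  two-letter-factors {y = _ ∷ []} ([] , _ , refl) = inj₂ (here refl)
  two-letter-factors {y = _ ∷ _ ∷ []} ([] , _ , refl) = inj₂ (there (there (here refl)))
  two-letter-factors {y = _ ∷ _ ∷ _ ∷ _} ([] , _ , ())
  two-letter-factors {y = _ ∷ []} (_ ∷ [] , _ , refl) = inj₂ (there (here refl))
  two-letter-factors {y = _ ∷ _ ∷ _} (_ ∷ [] , _ , ())
  two-letter-factors {y = _ ∷ _} (_ ∷ _ ∷ x , _ , e) =
    ⊥-elim (++-∷-nonempty x (sym (∷-injectiveʳ (∷-injectiveʳ e))))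

module Morphism {m n : ℕ} (h : Word m → Word n)
  (h-[] : h [] ≡ [])
  (h-++ : ∀ x y → h (x ++ y) ≡ h x ++ h y)
  (h-mono : ∀ {x y} → x <ₗ y → h x <ₗ h y) where

  open StrictlyMonotone _<ₗ_ _<ₗ_ <ₗ-compare <ₗ-asym h h-mono public
    renaming (injective to h-injective; reflects to h-reflects)

  h-power : ∀ j u → h (concat (replicate j u)) ≡ concat (replicate j (h u))
  h-power zero u = h-[]
  h-power (suc j) u = trans (h-++ u _) (cong (h u ++_) (h-power j u))

  lyndon-reflect : ∀ x → Lyndon (h x) → Lyndon x
  lyndon-reflect x (hx≢[] , hx-prim , hx-min) = x≢[] , x-prim , x-min
    where
    x≢[] : x ≢ []
    x≢[] refl = hx≢[] h-[]
    x-prim : Primitive x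
    x-prim u j x≡ = hx-prim (h u) j (trans (cong h x≡) (h-power j u))
    x-min : ∀ u v → x ≡ u ++ v → v ++ u ≢ x → x <ₗ (v ++ u)
    x-min u v x≡uv vu≢x = h-reflects (subst (h x <ₗ_) (sym (h-++ v u))
      (hx-min (h u) (h v) (trans (cong h x≡uv) (h-++ u v))
        (λ e → vu≢x (h-injective (trans (h-++ v u) e)))))

  factor-image : ∀ {y u} → Factor y u → Factor (h y) (h u)
  factor-image {y} (p , s , refl) = h p , h s , trans (h-++ p (y ++ s)) (cong (h p ++_) (h-++ y s))

  lift-count : ∀ {u m} (new : List (Word n)) → Unique new →
    (∀ {z} → z ∈ new → ∀ y → h y ≢ z) →
    (∀ {z} → z ∈ new → LyndonFactor z (h u)) →
    (∀ y → Lyndon y → Lyndon (h y)) →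
    (∀ {v} → LyndonFactor v (h u) → v ∈ new ⊎ ∃ λ y → v ≡ h y × Factor y u) →
    LyndonCount u m → LyndonCount (h u) (length new + m)
  lift-count {u} new new-unique new-fresh new-factor h-lyndon covers (ls , ls-unique , ls-length , ls-spec) =
    new ++ map h ls ,
    Unique.++⁺ new-unique (Unique.map⁺ h-injective ls-unique) disjoint ,
    trans (length-++ new) (cong (length new +_) (trans (length-map h ls) ls-length)) ,
    λ v → mk⇔ (sound v) (complete v)
    where
    disjoint : Disjoint new (map h ls)
    disjoint (z∈new , z∈image) with ∈-map⁻ h z∈image
    ... | y , _ , refl = new-fresh z∈new y refl
    sound : ∀ v → v ∈ new ++ map h ls → LyndonFactor v (h u)
    sound v v∈ with ∈-++⁻ new v∈
    ... | inj₁ v∈new = new-factor v∈new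
    ... | inj₂ v∈image with ∈-map⁻ h v∈image
    ...   | y , y∈ls , refl with Equivalence.to (ls-spec y) y∈ls
    ...     | y-lyndon , y-factor = h-lyndon y y-lyndon , factor-image y-factor
    complete : ∀ v → LyndonFactor v (h u) → v ∈ new ++ map h ls
    complete v v-factor with covers v-factor
    ... | inj₁ v∈new = ∈-++⁺ˡ v∈new
    ... | inj₂ (y , refl , y-factor) = ∈-++⁺ʳ new (∈-map⁺ h
          (Equivalence.from (ls-spec y) (lyndon-reflect y (proj₁ v-factor) , y-factor)))

  Synchronised : Set
  Synchronised = ∀ x U V → h x ≡ U ++ V → ∃₂ λ u v → x ≡ u ++ v × U ≡ h u × V ≡ h v

  module _ (sync : Synchronised) where

    sync-lyndon : ∀ y → Lyndon y → Lyndon (h y)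
    sync-lyndon y (y≢[] , y-prim , y-min) = hy≢[] , hy-prim , hy-min
      where
      hy≢[] : h y ≢ []
      hy≢[] e = y≢[] (h-injective (trans e (sym h-[])))
      hy-prim : Primitive (h y)
      hy-prim U zero e = ⊥-elim (hy≢[] e)
      hy-prim U (suc j) e with sync y U (concat (replicate j U)) e
      ... | u , _ , _ , refl , _ = y-prim u (suc j) (h-injective (trans e (sym (h-power (suc j) u))))
      hy-min : ∀ U V → h y ≡ U ++ V → V ++ U ≢ h y → h y <ₗ (V ++ U)
      hy-min U V e vu≢y with sync y U V e
      ... | u , v , y≡uv , refl , refl = subst (h y <ₗ_) (h-++ v u)
            (h-mono (y-min u v y≡uv (λ vu≡y → vu≢y (trans (sym (h-++ v u)) (cong h vu≡y)))))

    sync-factor : ∀ {v x} → Factor v (h x) → ∃ λ y → v ≡ h y × Factor y x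
    sync-factor {v} {x} (P , S , e) with sync x P (v ++ S) e
    ... | p , r , refl , refl , hr≡ with sync r v S (sym hr≡)
    ...   | y , s , refl , refl , refl = y , refl , p , s , refl

module LetterEmbedding {m k : ℕ} (e : Fin m → Fin k) (e-mono : ∀ {i j} → i < j → e i < e j) where

  map-mono : ∀ {x y} → x <ₗ y → map e x <ₗ map e y
  map-mono []<∷ = []<∷
  map-mono (here p) = here (e-mono p)
  map-mono (there p) = there (map-mono p)

  open Morphism (map e) refl (map-++ e) map-mono

  map-synchronised : Synchronised
  map-synchronised x [] V eq = [] , x , refl , refl , sym eq
  map-synchronised [] (c ∷ U) V ()
  map-synchronised (d ∷ x) (c ∷ U) V eq with ∷-injectiveˡ eq
  ... | refl with map-synchronised x U V (∷-injectiveʳ eq)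
  ...   | u , v , refl , refl , refl = d ∷ u , v , refl , refl , refl

  embedding-count : ∀ {x c} → LyndonCount x c → LyndonCount (map e x) c
  embedding-count = lift-count [] [] (λ ()) (λ ()) (sync-lyndon map-synchronised)
    (λ v-factor → inj₂ (sync-factor map-synchronised (proj₂ v-factor)))

Bin : Set
Bin = Word 2

pattern 𝚊 = zero
pattern 𝚋 = suc zero

𝚊<𝚋 : _<_ {2} {2} 𝚊 𝚋
𝚊<𝚋 = s≤s z≤n

other : Fin 2 → Fin 2
other 𝚊 = 𝚋
other 𝚋 = 𝚊

letter-cases : ∀ d c → c ≡ d ⊎ c ≡ other d
letter-cases 𝚊 𝚊 = inj₁ refl
letter-cases 𝚊 𝚋 = inj₂ refl
letter-cases 𝚋 𝚊 = inj₂ refl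
letter-cases 𝚋 𝚋 = inj₁ refl

last-view : ∀ {A : Set} (d : A) r → ∃₂ λ y l → d ∷ r ≡ y ++ l ∷ []
last-view d [] = [] , d , refl
last-view d (d′ ∷ r) with last-view d′ r
... | y , l , d′r≡ = d ∷ y , l , cong (d ∷_) d′r≡

𝚊-rotation : (z : Bin) → (𝚊 ∷ z) <ₗ (z ++ 𝚊 ∷ []) ⊎ z ≡ replicate (length z) 𝚊
𝚊-rotation [] = inj₂ refl
𝚊-rotation (𝚊 ∷ z) with 𝚊-rotation z
... | inj₁ smaller = inj₁ (there smaller)
... | inj₂ power = inj₂ (cong (𝚊 ∷_) power)
𝚊-rotation (𝚋 ∷ z) = inj₁ (here 𝚊<𝚋)

𝚋-rotation : (z : Bin) → (z ++ 𝚋 ∷ []) <ₗ (𝚋 ∷ z) ⊎ z ≡ replicate (length z) 𝚋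
𝚋-rotation [] = inj₂ refl
𝚋-rotation (𝚊 ∷ z) = inj₁ (here 𝚊<𝚋)
𝚋-rotation (𝚋 ∷ z) with 𝚋-rotation z
... | inj₁ smaller = inj₁ (there smaller)
... | inj₂ power = inj₂ (cong (𝚋 ∷_) power)

lyndon-starts-𝚊 : ∀ {c d : Fin 2} {r : Bin} → Lyndon (c ∷ d ∷ r) → c ≡ 𝚊
lyndon-starts-𝚊 {𝚊} _ = refl
lyndon-starts-𝚊 {𝚋} {d} {r} L@(_ , prim , _) with 𝚋-rotation (d ∷ r)
... | inj₁ smaller = ⊥-elim (no-smaller-rotation L (𝚋 ∷ []) (d ∷ r) refl smaller)
... | inj₂ power = ⊥-elim (letter-power-imprimitive 𝚋 (length r) (subst Primitive (cong (𝚋 ∷_) power) prim))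

lyndon-not-end-𝚊 : ∀ {c : Fin 2} (y : Bin) → ¬ Lyndon (c ∷ y ++ 𝚊 ∷ [])
lyndon-not-end-𝚊 {c} y L@(_ , prim , _) with 𝚊-rotation (c ∷ y)
... | inj₁ smaller = no-smaller-rotation L (c ∷ y) (𝚊 ∷ []) refl smaller
... | inj₂ power = letter-power-imprimitive 𝚊 (length y) (subst Primitive
        (trans (cong (_++ 𝚊 ∷ []) power) (replicate-snoc (suc (length y)) 𝚊)) prim)

lyndon-ends-𝚋 : ∀ {c d : Fin 2} {r : Bin} → Lyndon (c ∷ d ∷ r) → ∃ λ y → c ∷ d ∷ r ≡ y ++ 𝚋 ∷ []
lyndon-ends-𝚋 {c} {d} {r} L with last-view d r
... | y , 𝚋 , dr≡ = c ∷ y , cong (c ∷_) dr≡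
... | y , 𝚊 , dr≡ = ⊥-elim (lyndon-not-end-𝚊 y (subst Lyndon (cong (c ∷_) dr≡) L))

CutsBefore𝚊 : (Bin → Bin) → Set
CutsBefore𝚊 h = ∀ x P S → h x ≡ P ++ 𝚊 ∷ S → ∃₂ λ p s → x ≡ p ++ s × P ≡ h p × 𝚊 ∷ S ≡ h s

CutsAfter𝚋 : (Bin → Bin) → Set
CutsAfter𝚋 h = ∀ x P S → h x ≡ P ++ 𝚋 ∷ S → ∃₂ λ p s → x ≡ p ++ s × P ++ 𝚋 ∷ [] ≡ h p × S ≡ h s

module Sturmian (h : Bin → Bin)
  (h-[] : h [] ≡ [])
  (h-++ : ∀ x y → h (x ++ y) ≡ h x ++ h y)
  (h-mono : ∀ {x y} → x <ₗ y → h x <ₗ h y)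
  (cut-𝚊 : CutsBefore𝚊 h) (cut-𝚋 : CutsAfter𝚋 h)
  (h-start : ∀ x → Lyndon x → (∃ λ r → h x ≡ 𝚊 ∷ r) ⊎ h x ≡ 𝚋 ∷ []) where

  open Morphism h h-[] h-++ h-mono public

  -- h maps Lyndon words to Lyndon words: a period of h x or a smaller rotation
  -- would have to cut h x before an 𝚊, hence come from one of x.
  h-lyndon : ∀ x → Lyndon x → Lyndon (h x)
  h-lyndon x L@(x≢[] , x-prim , x-min) = hx≢[] , hx-prim , hx-min
    where
    hx≢[] : h x ≢ []
    hx≢[] e = x≢[] (h-injective (trans e (sym h-[])))
    hx-prim : Primitive (h x)
    hx-prim U zero e = ⊥-elim (hx≢[] e)
    hx-prim U (suc zero) e = refl
    hx-prim [] (suc (suc j)) e = ⊥-elim (hx≢[] (trans e (power-of-[] j)))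
    hx-prim (c ∷ U) (suc (suc j)) e with h-start x L
    ... | inj₂ hx≡𝚋 = ⊥-elim (++-∷-nonempty U (sym (∷-injectiveʳ (trans (sym hx≡𝚋) e))))
    ... | inj₁ (r , hx≡𝚊r) with ∷-injectiveˡ (trans (sym e) hx≡𝚊r)
    ...   | refl with cut-𝚊 x (𝚊 ∷ U) (U ++ concat (replicate j (𝚊 ∷ U))) e
    ...     | p , _ , _ , U≡hp , _
              with x-prim p (suc (suc j)) (h-injective (trans e (trans
                     (cong (λ z → concat (replicate (suc (suc j)) z)) U≡hp) (sym (h-power (suc (suc j)) p)))))
    ...       | ()
    hx-min : ∀ U V → h x ≡ U ++ V → V ++ U ≢ h x → h x <ₗ (V ++ U)
    hx-min U [] e vu≢x = ⊥-elim (vu≢x (sym (trans e (++-identityʳ U))))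
    hx-min U (𝚊 ∷ V) e vu≢x with cut-𝚊 x U V e
    ... | p , s , x≡ps , refl , 𝚊V≡hs = subst (h x <ₗ_) (trans (h-++ s p) (cong (_++ h p) (sym 𝚊V≡hs)))
          (h-mono (x-min p s x≡ps (λ sp≡x →
            vu≢x (trans (cong (_++ h p) 𝚊V≡hs) (trans (sym (h-++ s p)) (cong h sp≡x))))))
    hx-min U (𝚋 ∷ V) e vu≢x with h-start x L
    ... | inj₁ (r , hx≡𝚊r) = subst (_<ₗ (𝚋 ∷ V ++ U)) (sym hx≡𝚊r) (here 𝚊<𝚋)
    ... | inj₂ hx≡𝚋 = ⊥-elim (vu≢x (trans (letter-rotation U (𝚋 ∷ V) (trans (sym hx≡𝚋) e)) (sym hx≡𝚋)))

  factor-lift : ∀ {u y₁ y₂} → 𝚊 ∷ y₁ ≡ y₂ ++ 𝚋 ∷ [] → Factor (𝚊 ∷ y₁) (h u) →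
                ∃ λ y → 𝚊 ∷ y₁ ≡ h y × Factor y u
  factor-lift {u} {y₁} {y₂} ends-𝚋 (P , S , hu≡) with cut-𝚊 u P (y₁ ++ S) hu≡
  ... | p , r , refl , refl , hr≡
        with cut-𝚋 r y₂ S (trans (sym hr≡) (trans (cong (_++ S) ends-𝚋) (++-assoc y₂ (𝚋 ∷ []) S)))
  ...   | y , s , refl , y-image , refl = y , trans ends-𝚋 y-image , p , s , refl

  module Counting (fresh : Fin 2)
    (h-kept : h (other fresh ∷ []) ≡ other fresh ∷ [])
    (fresh-not-image : ∀ y → h y ≢ fresh ∷ [])
    (fresh-in-image : Factor (fresh ∷ []) (h (fresh ∷ []))) where

    count-step : ∀ {u m} → (∀ c → Factor (c ∷ []) u) → LyndonCount u m → LyndonCount (h u) (suc m)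
    count-step {u} letters = lift-count ((fresh ∷ []) ∷ []) ([] ∷ [])
      (λ { (here refl) → fresh-not-image })
      (λ { (here refl) → letter-lyndon fresh , factor-trans fresh-in-image (factor-image (letters fresh)) })
      h-lyndon covers
      where
      covers : ∀ {v} → LyndonFactor v (h u) → v ∈ (fresh ∷ []) ∷ [] ⊎ ∃ λ y → v ≡ h y × Factor y u
      covers {[]} ((v≢[] , _) , _) = ⊥-elim (v≢[] refl)
      covers {c ∷ []} _ with letter-cases fresh c
      ... | inj₁ refl = inj₁ (here refl)
      ... | inj₂ refl = inj₂ (other fresh ∷ [] , sym h-kept , letters (other fresh))
      covers {c ∷ d ∷ r} (L , v-factor) with lyndon-starts-𝚊 L | lyndon-ends-𝚋 L
      ... | refl | _ , ends-𝚋 = inj₂ (factor-lift ends-𝚋 v-factor)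

φ : Bin → Bin
φ [] = []
φ (𝚊 ∷ x) = 𝚊 ∷ φ x
φ (𝚋 ∷ x) = 𝚊 ∷ 𝚋 ∷ φ x

ψ : Bin → Bin
ψ [] = []
ψ (𝚊 ∷ x) = 𝚊 ∷ 𝚋 ∷ ψ x
ψ (𝚋 ∷ x) = 𝚋 ∷ ψ x

φ-++ : ∀ x y → φ (x ++ y) ≡ φ x ++ φ y
φ-++ [] y = refl
φ-++ (𝚊 ∷ x) y = cong (𝚊 ∷_) (φ-++ x y)
φ-++ (𝚋 ∷ x) y = cong (λ z → 𝚊 ∷ 𝚋 ∷ z) (φ-++ x y)

ψ-++ : ∀ x y → ψ (x ++ y) ≡ ψ x ++ ψ y
ψ-++ [] y = refl
ψ-++ (𝚊 ∷ x) y = cong (λ z → 𝚊 ∷ 𝚋 ∷ z) (ψ-++ x y)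
ψ-++ (𝚋 ∷ x) y = cong (𝚋 ∷_) (ψ-++ x y)

φ-below-𝚋 : ∀ x r → φ x <ₗ (𝚋 ∷ r)
φ-below-𝚋 [] r = []<∷
φ-below-𝚋 (𝚊 ∷ x) r = here 𝚊<𝚋
φ-below-𝚋 (𝚋 ∷ x) r = here 𝚊<𝚋

φ-mono : ∀ {x y} → x <ₗ y → φ x <ₗ φ y
φ-mono {y = 𝚊 ∷ _} []<∷ = []<∷
φ-mono {y = 𝚋 ∷ _} []<∷ = []<∷
φ-mono (here {𝚊} {𝚋} {xs} _) = there (φ-below-𝚋 xs _)
φ-mono (here {𝚊} {𝚊} ())
φ-mono (here {𝚋} {𝚊} ())
φ-mono (here {𝚋} {𝚋} (s≤s ()))
φ-mono (there {𝚊} p) = there (φ-mono p)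
φ-mono (there {𝚋} p) = there (there (φ-mono p))

ψ-mono : ∀ {x y} → x <ₗ y → ψ x <ₗ ψ y
ψ-mono {y = 𝚊 ∷ _} []<∷ = []<∷
ψ-mono {y = 𝚋 ∷ _} []<∷ = []<∷
ψ-mono (here {𝚊} {𝚋} _) = here 𝚊<𝚋
ψ-mono (here {𝚊} {𝚊} ())
ψ-mono (here {𝚋} {𝚊} ())
ψ-mono (here {𝚋} {𝚋} (s≤s ()))
ψ-mono (there {𝚊} p) = there (there (ψ-mono p))
ψ-mono (there {𝚋} p) = there (ψ-mono p)

φ-cut-𝚊 : CutsBefore𝚊 φ
φ-cut-𝚊 [] P S e = ⊥-elim (++-∷-nonempty P (sym e))
φ-cut-𝚊 (c ∷ x) [] S e = [] , c ∷ x , refl , refl , sym e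
φ-cut-𝚊 (𝚊 ∷ x) (𝚊 ∷ P) S e with φ-cut-𝚊 x P S (∷-injectiveʳ e)
... | p , s , refl , refl , 𝚊S≡ = 𝚊 ∷ p , s , refl , refl , 𝚊S≡
φ-cut-𝚊 (𝚋 ∷ x) (𝚊 ∷ 𝚋 ∷ P) S e with φ-cut-𝚊 x P S (∷-injectiveʳ (∷-injectiveʳ e))
... | p , s , refl , refl , 𝚊S≡ = 𝚋 ∷ p , s , refl , refl , 𝚊S≡
φ-cut-𝚊 (𝚊 ∷ x) (𝚋 ∷ P) S ()
φ-cut-𝚊 (𝚋 ∷ x) (𝚋 ∷ P) S ()
φ-cut-𝚊 (𝚋 ∷ x) (𝚊 ∷ []) S ()
φ-cut-𝚊 (𝚋 ∷ x) (𝚊 ∷ 𝚊 ∷ P) S ()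

φ-cut-𝚋 : CutsAfter𝚋 φ
φ-cut-𝚋 [] P S e = ⊥-elim (++-∷-nonempty P (sym e))
φ-cut-𝚋 (𝚊 ∷ x) (𝚊 ∷ P) S e with φ-cut-𝚋 x P S (∷-injectiveʳ e)
... | p , s , refl , P𝚋≡ , refl = 𝚊 ∷ p , s , refl , cong (𝚊 ∷_) P𝚋≡ , refl
φ-cut-𝚋 (𝚋 ∷ x) (𝚊 ∷ []) S refl = 𝚋 ∷ [] , x , refl , refl , refl
φ-cut-𝚋 (𝚋 ∷ x) (𝚊 ∷ 𝚋 ∷ P) S e with φ-cut-𝚋 x P S (∷-injectiveʳ (∷-injectiveʳ e))
... | p , s , refl , P𝚋≡ , refl = 𝚋 ∷ p , s , refl , cong (λ z → 𝚊 ∷ 𝚋 ∷ z) P𝚋≡ , refl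
φ-cut-𝚋 (𝚊 ∷ x) [] S ()
φ-cut-𝚋 (𝚋 ∷ x) [] S ()
φ-cut-𝚋 (𝚊 ∷ x) (𝚋 ∷ P) S ()
φ-cut-𝚋 (𝚋 ∷ x) (𝚋 ∷ P) S ()
φ-cut-𝚋 (𝚋 ∷ x) (𝚊 ∷ 𝚊 ∷ P) S ()

ψ-cut-𝚊 : CutsBefore𝚊 ψ
ψ-cut-𝚊 [] P S e = ⊥-elim (++-∷-nonempty P (sym e))
ψ-cut-𝚊 (𝚊 ∷ x) [] S refl = [] , 𝚊 ∷ x , refl , refl , refl
ψ-cut-𝚊 (𝚊 ∷ x) (𝚊 ∷ 𝚋 ∷ P) S e with ψ-cut-𝚊 x P S (∷-injectiveʳ (∷-injectiveʳ e))
... | p , s , refl , refl , 𝚊S≡ = 𝚊 ∷ p , s , refl , refl , 𝚊S≡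
ψ-cut-𝚊 (𝚋 ∷ x) (𝚋 ∷ P) S e with ψ-cut-𝚊 x P S (∷-injectiveʳ e)
... | p , s , refl , refl , 𝚊S≡ = 𝚋 ∷ p , s , refl , refl , 𝚊S≡
ψ-cut-𝚊 (𝚋 ∷ x) [] S ()
ψ-cut-𝚊 (𝚊 ∷ x) (𝚊 ∷ []) S ()
ψ-cut-𝚊 (𝚊 ∷ x) (𝚊 ∷ 𝚊 ∷ P) S ()
ψ-cut-𝚊 (𝚊 ∷ x) (𝚋 ∷ P) S ()
ψ-cut-𝚊 (𝚋 ∷ x) (𝚊 ∷ P) S ()

ψ-cut-𝚋 : CutsAfter𝚋 ψ
ψ-cut-𝚋 [] P S e = ⊥-elim (++-∷-nonempty P (sym e))
ψ-cut-𝚋 (𝚋 ∷ x) [] S refl = 𝚋 ∷ [] , x , refl , refl , refl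
ψ-cut-𝚋 (𝚊 ∷ x) (𝚊 ∷ []) S refl = 𝚊 ∷ [] , x , refl , refl , refl
ψ-cut-𝚋 (𝚊 ∷ x) (𝚊 ∷ 𝚋 ∷ P) S e with ψ-cut-𝚋 x P S (∷-injectiveʳ (∷-injectiveʳ e))
... | p , s , refl , P𝚋≡ , refl = 𝚊 ∷ p , s , refl , cong (λ z → 𝚊 ∷ 𝚋 ∷ z) P𝚋≡ , refl
ψ-cut-𝚋 (𝚋 ∷ x) (𝚋 ∷ P) S e with ψ-cut-𝚋 x P S (∷-injectiveʳ e)
... | p , s , refl , P𝚋≡ , refl = 𝚋 ∷ p , s , refl , cong (𝚋 ∷_) P𝚋≡ , refl
ψ-cut-𝚋 (𝚊 ∷ x) [] S ()
ψ-cut-𝚋 (𝚊 ∷ x) (𝚊 ∷ 𝚊 ∷ P) S ()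
ψ-cut-𝚋 (𝚊 ∷ x) (𝚋 ∷ P) S ()
ψ-cut-𝚋 (𝚋 ∷ x) (𝚊 ∷ P) S ()

φ-start : ∀ x → Lyndon x → (∃ λ r → φ x ≡ 𝚊 ∷ r) ⊎ φ x ≡ 𝚋 ∷ []
φ-start [] (x≢[] , _) = ⊥-elim (x≢[] refl)
φ-start (𝚊 ∷ x) _ = inj₁ (_ , refl)
φ-start (𝚋 ∷ x) _ = inj₁ (_ , refl)

ψ-start : ∀ x → Lyndon x → (∃ λ r → ψ x ≡ 𝚊 ∷ r) ⊎ ψ x ≡ 𝚋 ∷ []
ψ-start [] (x≢[] , _) = ⊥-elim (x≢[] refl)
ψ-start (𝚊 ∷ x) _ = inj₁ (_ , refl)
ψ-start (𝚋 ∷ []) _ = inj₂ refl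
ψ-start (𝚋 ∷ d ∷ r) L with lyndon-starts-𝚊 L
... | ()

φ-not-𝚋 : ∀ y → φ y ≢ 𝚋 ∷ []
φ-not-𝚋 [] ()
φ-not-𝚋 (𝚊 ∷ _) ()
φ-not-𝚋 (𝚋 ∷ _) ()

ψ-not-𝚊 : ∀ y → ψ y ≢ 𝚊 ∷ []
ψ-not-𝚊 [] ()
ψ-not-𝚊 (𝚊 ∷ _) ()
ψ-not-𝚊 (𝚋 ∷ _) ()

module Φ = Sturmian φ refl φ-++ φ-mono φ-cut-𝚊 φ-cut-𝚋 φ-start
module Ψ = Sturmian ψ refl ψ-++ ψ-mono ψ-cut-𝚊 ψ-cut-𝚋 ψ-start

count-φ : ∀ {u m} → (∀ c → Factor (c ∷ []) u) → LyndonCount u m → LyndonCount (φ u) (suc m)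
count-φ = Φ.Counting.count-step 𝚋 refl φ-not-𝚋 (𝚊 ∷ [] , [] , refl)

count-ψ : ∀ {u m} → (∀ c → Factor (c ∷ []) u) → LyndonCount u m → LyndonCount (ψ u) (suc m)
count-ψ = Ψ.Counting.count-step 𝚊 refl ψ-not-𝚊 ([] , 𝚋 ∷ [] , refl)

𝚊𝚋-count : LyndonCount (𝚊 ∷ 𝚋 ∷ []) 3
𝚊𝚋-count = (𝚊 ∷ []) ∷ (𝚋 ∷ []) ∷ (𝚊 ∷ 𝚋 ∷ []) ∷ [] ,
  ((λ ()) ∷ (λ ()) ∷ []) ∷ ((λ ()) ∷ []) ∷ [] ∷ [] ,
  refl , λ _ → mk⇔ sound complete
  where
  sound : ∀ {v} → v ∈ (𝚊 ∷ []) ∷ (𝚋 ∷ []) ∷ (𝚊 ∷ 𝚋 ∷ []) ∷ [] → LyndonFactor v (𝚊 ∷ 𝚋 ∷ [])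
  sound (here refl) = letter-lyndon 𝚊 , [] , 𝚋 ∷ [] , refl
  sound (there (here refl)) = letter-lyndon 𝚋 , 𝚊 ∷ [] , [] , refl
  sound (there (there (here refl))) = Φ.h-lyndon (𝚋 ∷ []) (letter-lyndon 𝚋) , [] , [] , refl
  complete : ∀ {v} → LyndonFactor v (𝚊 ∷ 𝚋 ∷ []) → v ∈ (𝚊 ∷ []) ∷ (𝚋 ∷ []) ∷ (𝚊 ∷ 𝚋 ∷ []) ∷ []
  complete ((v≢[] , _) , v-factor) with two-letter-factors v-factor
  ... | inj₁ v≡[] = ⊥-elim (v≢[] v≡[])
  ... | inj₂ v∈ = v∈

θ : List Bool → List Bool
θ [] = []
θ (false ∷ x) = false ∷ true ∷ θ x
θ (true ∷ x) = false ∷ θ x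

θ-++ : ∀ x y → θ (x ++ y) ≡ θ x ++ θ y
θ-++ [] y = refl
θ-++ (false ∷ x) y = cong (λ z → false ∷ true ∷ z) (θ-++ x y)
θ-++ (true ∷ x) y = cong (false ∷_) (θ-++ x y)

fib-θ : ∀ n → θ (fibW (suc n)) ≡ fibW (suc (suc n))
fib-θ zero = refl
fib-θ (suc zero) = refl
fib-θ (suc (suc n)) = trans (θ-++ (fibW (suc (suc n))) (fibW (suc n))) (cong₂ _++_ (fib-θ (suc n)) (fib-θ n))

-- pFib j is p_{j+3}, computed by the recursion p_{n+1} = θ(p_n) 𝚊.
pFib : ℕ → List Bool
pFib zero = []
pFib (suc j) = θ (pFib j) ++ false ∷ []

θ-step : ∀ j x {d} → fibW (3 + j) ≡ x ++ d → fibW (4 + j) ≡ θ x ++ θ d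
θ-step j x {d} e = trans (sym (fib-θ (2 + j))) (trans (cong θ e) (θ-++ x d))

fib-shape : ∀ j → fibW (3 + j) ≡ pFib j ++ false ∷ true ∷ [] ⊎ fibW (3 + j) ≡ pFib j ++ true ∷ false ∷ []
fib-shape zero = inj₁ refl
fib-shape (suc j) with fib-shape j
... | inj₁ e = inj₂ (trans (θ-step j (pFib j) e) (sym (++-assoc (θ (pFib j)) (false ∷ []) (true ∷ false ∷ []))))
... | inj₂ e = inj₁ (trans (θ-step j (pFib j) e) (sym (++-assoc (θ (pFib j)) (false ∷ []) (false ∷ true ∷ []))))

take-length-++ : ∀ {A : Set} (x y : List A) → take (length x) (x ++ y) ≡ x
take-length-++ [] y = refl
take-length-++ (c ∷ x) y = cong (c ∷_) (take-length-++ x y)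

drop-last-two : ∀ {A : Set} (x : List A) c d → take (length (x ++ c ∷ d ∷ []) ∸ 2) (x ++ c ∷ d ∷ []) ≡ x
drop-last-two x c d = begin
  take (length (x ++ c ∷ d ∷ []) ∸ 2) (x ++ c ∷ d ∷ [])  ≡⟨ cong (λ l → take (l ∸ 2) (x ++ c ∷ d ∷ [])) (length-++ x) ⟩
  take (length x + 2 ∸ 2) (x ++ c ∷ d ∷ [])              ≡⟨ cong (λ l → take l (x ++ c ∷ d ∷ [])) (m+n∸n≡m (length x) 2) ⟩
  take (length x) (x ++ c ∷ d ∷ [])                      ≡⟨ take-length-++ x (c ∷ d ∷ []) ⟩
  x                                                      ∎
  where open ≡-Reasoning

p≡pFib : ∀ j → pW (3 + j) ≡ pFib j
p≡pFib j with fib-shape j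
... | inj₁ e = trans (cong (λ w → take (length w ∸ 2) w) e) (drop-last-two (pFib j) false true)
... | inj₂ e = trans (cong (λ w → take (length w ∸ 2) w) e) (drop-last-two (pFib j) true false)

p-step : ∀ j → pW (4 + j) ≡ θ (pW (3 + j)) ++ false ∷ []
p-step j = trans (p≡pFib (suc j)) (cong (λ p → θ p ++ false ∷ []) (sym (p≡pFib j)))

toBin : Bool → Fin 2
toBin false = 𝚊
toBin true = 𝚋

framed : Bin → Bin
framed r = 𝚊 ∷ r ++ 𝚋 ∷ []

framed-letters : ∀ r c → Factor (c ∷ []) (framed r)
framed-letters r 𝚊 = [] , r ++ 𝚋 ∷ [] , refl
framed-letters r 𝚋 = 𝚊 ∷ r , [] , refl

fibLyndon₁ fibLyndon₂ : ℕ → Bin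
fibLyndon₁ j = framed (map toBin (pW (3 + j)))
fibLyndon₂ j = framed (map toBin (map not (pW (3 + j))))

-- θ(x) 𝚊 𝚋 = φ(c(x) 𝚋), since θ agrees with φ ∘ c on letters.
θ-via-φ : ∀ x → map toBin (θ x ++ false ∷ []) ++ 𝚋 ∷ [] ≡ φ (map toBin (map not x) ++ 𝚋 ∷ [])
θ-via-φ [] = refl
θ-via-φ (false ∷ x) = cong (λ z → 𝚊 ∷ 𝚋 ∷ z) (θ-via-φ x)
θ-via-φ (true ∷ x) = cong (𝚊 ∷_) (θ-via-φ x)

-- c(θ(x) 𝚊) 𝚋 = 𝚋 ψ(x 𝚋), a conjugation between c ∘ θ and ψ.
θ-via-ψ : ∀ x → map toBin (map not (θ x ++ false ∷ [])) ++ 𝚋 ∷ [] ≡ 𝚋 ∷ ψ (map toBin x ++ 𝚋 ∷ [])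
θ-via-ψ [] = refl
θ-via-ψ (false ∷ x) = cong (λ z → 𝚋 ∷ 𝚊 ∷ z) (θ-via-ψ x)
θ-via-ψ (true ∷ x) = cong (𝚋 ∷_) (θ-via-ψ x)

step-φ : ∀ j → fibLyndon₁ (suc j) ≡ φ (fibLyndon₂ j)
step-φ j = begin
  fibLyndon₁ (suc j)                                   ≡⟨ cong (λ p → framed (map toBin p)) (p-step j) ⟩
  framed (map toBin (θ (pW (3 + j)) ++ false ∷ []))    ≡⟨ cong (𝚊 ∷_) (θ-via-φ (pW (3 + j))) ⟩
  φ (fibLyndon₂ j)                                     ∎
  where open ≡-Reasoning

step-ψ : ∀ j → fibLyndon₂ (suc j) ≡ ψ (fibLyndon₁ j)
step-ψ j = begin
  fibLyndon₂ (suc j)                                          ≡⟨ cong (λ p → framed (map toBin (map not p))) (p-step j) ⟩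
  framed (map toBin (map not (θ (pW (3 + j)) ++ false ∷ [])))  ≡⟨ cong (𝚊 ∷_) (θ-via-ψ (pW (3 + j))) ⟩
  ψ (fibLyndon₁ j)                                            ∎
  where open ≡-Reasoning

fibonacci-count : ∀ j → LyndonCount (fibLyndon₁ j) (3 + j) × LyndonCount (fibLyndon₂ j) (3 + j)
fibonacci-count zero = 𝚊𝚋-count , 𝚊𝚋-count
fibonacci-count (suc j) with fibonacci-count j
... | count₁ , count₂ =
  subst (λ w → LyndonCount w (4 + j)) (sym (step-φ j)) (count-φ (framed-letters _) count₂) ,
  subst (λ w → LyndonCount w (4 + j)) (sym (step-ψ j)) (count-ψ (framed-letters _) count₁)

pair : ∀ {k} → Fin k → Fin k → Fin 2 → Fin k
pair a b 𝚊 = a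
pair a b 𝚋 = b

pair-mono : ∀ {k} {a b : Fin k} → a < b → ∀ {i j} → i < j → pair a b i < pair a b j
pair-mono a<b {𝚊} {𝚋} _ = a<b
pair-mono a<b {𝚊} {𝚊} ()
pair-mono a<b {𝚋} {𝚊} ()
pair-mono a<b {𝚋} {𝚋} (s≤s ())

pair-framed : ∀ {k} (a b : Fin k) r → map (pair a b) (map toBin r ++ 𝚋 ∷ []) ≡ map (embed a b) r ++ b ∷ []
pair-framed a b [] = refl
pair-framed a b (false ∷ r) = cong (a ∷_) (pair-framed a b r)
pair-framed a b (true ∷ r) = cong (b ∷_) (pair-framed a b r)

embedded-count : ∀ {k} {a b : Fin k} → a < b → ∀ r {m} →
  LyndonCount (framed (map toBin r)) m → LyndonCount (a ∷ map (embed a b) r ++ b ∷ []) m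
embedded-count {a = a} {b} a<b r {m} count =
  subst (λ w → LyndonCount w m) (cong (a ∷_) (pair-framed a b r))
    (LetterEmbedding.embedding-count (pair a b) (pair-mono a<b) count)

lemma9 : (k n : ℕ) (w : Word k) → 3 ≤ n → FibLyndon n w → LyndonCount w n
lemma9 k (suc (suc (suc j))) w (s≤s (s≤s (s≤s _))) (a , b , a<b , inj₁ w≡) =
  subst (λ z → LyndonCount z (3 + j)) (sym w≡)
    (embedded-count a<b (pW (3 + j)) (proj₁ (fibonacci-count j)))
lemma9 k (suc (suc (suc j))) w (s≤s (s≤s (s≤s _))) (a , b , a<b , inj₂ w≡) =
  subst (λ z → LyndonCount z (3 + j)) (sym w≡)
    (embedded-count a<b (map not (pW (3 + j))) (proj₂ (fibonacci-count j)))
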